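{- Let $n$ be odd and let $v\in\mathbb{Z}[i]^n$ be a column of some $n$-icube in $\mathbb{Z}[i]^n$ of norm $\lambda$. Then $\lambda\in\mathbb{Z}$ is a sum of two squares of rational integers.
   Context: For a complex matrix $M$, $M^*=\overline{M}^T$ is its conjugate transpose. For $1\leq k\leq n$, a matrix $(v_1|\dots|v_k)\in\mathbb{Z}[i]^{n\times k}$ is a $k$-icube in $\mathbb{Z}[i]^n$ of norm $\lambda>0$ if $v_i^*v_j=\lambda$ for $i=j$ and $v_i^*v_j=0$ for $i\neq j$. -}

module Defs where

open import Data.Nat using (ℕ; zero; suc)
open import Data.Fin using (Fin; zero; suc)
open import Data.Integer using (ℤ; _+_; _-_; _*_; -_; 0ℤ)
open import Relation.Binary.PropositionalEquality using (_≡_)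
open import Relation.Nullary using (¬_)

record ℤ[i] : Set where
  constructor _+_i
  field
    re : ℤ
    im : ℤ
open ℤ[i] public

ι : ℤ → ℤ[i]
ι z = z + 0ℤ i

0ᵍ : ℤ[i]
0ᵍ = ι 0ℤ

_+ᵍ_ : ℤ[i] → ℤ[i] → ℤ[i]
(a + b i) +ᵍ (c + d i) = (a + c) + (b + d) i

_*ᵍ_ : ℤ[i] → ℤ[i] → ℤ[i]
(a + b i) *ᵍ (c + d i) = (a * c - b * d) + (a * d + b * c) i

conj : ℤ[i] → ℤ[i]
conj (a + b i) = a + (- b) i

Σᵍ : (n : ℕ) → (Fin n → ℤ[i]) → ℤ[i]
Σᵍ zero    f = 0ᵍ
Σᵍ (suc n) f = f zero +ᵍ Σᵍ n (λ k → f (suc k))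

_*·_ : {n : ℕ} → (Fin n → ℤ[i]) → (Fin n → ℤ[i]) → ℤ[i]
_*·_ {n} u w = Σᵍ n (λ k → conj (u k) *ᵍ w k)

-- An n×k matrix over ℤ[i], M r c = entry in row r, column c.
Matrix : ℕ → ℕ → Set
Matrix n k = Fin n → Fin k → ℤ[i]

col : {n k : ℕ} → Matrix n k → Fin k → (Fin n → ℤ[i])
col M c = λ r → M r c

-- M = (v_1|…|v_k) is a k-icube of norm λ:  v_i* v_i = λ,  v_i* v_j = 0 (i ≠ j).
-- (λ > 0 is imposed separately.)
IsIcube : (n k : ℕ) → ℤ → Matrix n k → Set
IsIcube n k λ' M =
  ((c : Fin k) → col M c *· col M c ≡ ι λ') ×'
  ((c d : Fin k) → ¬ (c ≡ d) → col M c *· col M d ≡ 0ᵍ)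
  where
  open import Data.Product using () renaming (_×_ to _×'_)

-- If M is an n-icube of norm λ then M* M = λ I, so λⁿ = N (det M) is a norm from ℤ[i]; for odd n = 2m + 1,
-- λ = λⁿ / (λᵐ)² is then a sum of two rational squares, hence of two integer squares by the Davenport–Cassels descent.
-- Determinants are avoided: more generally, if the Hermitian form with positive diagonal weights D has an orthogonal
-- basis with norms E, then ∏ D · ∏ E is a norm from ℚ(i). Similitudes built from 2 × 2 rotations move the first basis
-- vector onto the first axis; this splits off one coordinate, and we induct on the dimension.

module Submission where

open import Defs renaming (_+ᵍ_ to infixl 6 _+ᵍ_; _*ᵍ_ to infixl 7 _*ᵍ_)
open import Algebra.Bundles using (CommutativeRing)
open import Algebra.Consequences.Propositional using (comm∧distrˡ⇒distrʳ; comm∧idˡ⇒id; comm∧invˡ⇒inv)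
import Algebra.Properties.CommutativeMonoid.Sum as CommutativeMonoidSum
open import Algebra.Structures using (IsCommutativeRing)
open import Data.Empty using (⊥-elim)
open import Data.Fin using (Fin; zero; suc)
open import Data.Fin.Properties using (suc-injective)
open import Data.Integer using (ℤ; +_; +0; +[1+_]; -[1+_]; _+_; _-_; _*_; -_; _^_; 0ℤ; 1ℤ; _≤_; _<_; +≤+; +<+; _/ℕ_; _%ℕ_; nonNegative; positive; >-nonZero)
import Data.Integer.Properties as ℤ
open import Data.Integer.DivMod using (a≡a%ℕn+[a/ℕn]*n; n%ℕd<d)
open import Data.Integer.Tactic.RingSolver using (solve-∀)
open import Data.Maybe using (Maybe; just; nothing)
open import Data.Nat as ℕ using (ℕ; zero; suc; s≤s; z≤n; s≤s⁻¹) renaming (_*_ to _*ℕ_)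
import Data.Nat.Properties as ℕ
open import Data.Nat.Induction using (<-rec)
open import Data.Product using (Σ; ∃-syntax; _×_; _,_; proj₁; proj₂)
open import Data.Sum using (_⊎_; inj₁; inj₂; reduce)
open import Data.Vec.Functional using (Vector; _∷_; head; tail)
open import Function using (_∘_; _⟨_⟩_)
open import Relation.Binary.PropositionalEquality
open import Relation.Nullary using (Dec; yes; no)
import Tactic.RingSolver as Solver
open import Tactic.RingSolver.Core.AlmostCommutativeRing using (AlmostCommutativeRing; fromCommutativeRing)

open CommutativeMonoidSum ℤ.*-1-commutativeMonoid using () renaming (sum to ∏; ∑-distrib-+ to ∏-distrib-*)

*-pos : ∀ {a b} → 0ℤ < a → 0ℤ < b → 0ℤ < a * b
*-pos {+[1+ _ ]} {+[1+ _ ]} _ _ = +<+ (s≤s z≤n)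
*-pos {+0} (+<+ ()) _
*-pos {+[1+ _ ]} {+0} _ (+<+ ())

^-pos : ∀ {a} n → 0ℤ < a → 0ℤ < a ^ n
^-pos zero a>0 = +<+ (s≤s z≤n)
^-pos (suc n) a>0 = *-pos a>0 (^-pos n a>0)

^-distribʳ-* : ∀ a b n → (a * b) ^ n ≡ a ^ n * b ^ n
^-distribʳ-* a b zero = refl
^-distribʳ-* a b (suc n) = trans (cong (a * b *_) (^-distribʳ-* a b n)) (interchange a b (a ^ n) (b ^ n))
  where
  interchange : ∀ a b c d → a * b * (c * d) ≡ a * c * (b * d)
  interchange = solve-∀

*-nonNeg : ∀ {a b} → 0ℤ ≤ a → 0ℤ ≤ b → 0ℤ ≤ a * b
*-nonNeg {+ m} {+ n} _ _ = subst (0ℤ ≤_) (ℤ.pos-* m n) (+≤+ z≤n)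

square-nonNeg : ∀ a → 0ℤ ≤ a * a
square-nonNeg (+ n) = *-nonNeg {+ n} {+ n} (+≤+ z≤n) (+≤+ z≤n)
square-nonNeg -[1+ n ] = square-nonNeg +[1+ n ]

0<i∧0≤i*j⇒0≤j : ∀ {i j} → 0ℤ < i → 0ℤ ≤ i * j → 0ℤ ≤ j
0<i∧0≤i*j⇒0≤j {i} {j} i>0 0≤ij =
  ℤ.*-cancelˡ-≤-pos 0ℤ j i {{positive i>0}} (subst (_≤ i * j) (sym (ℤ.*-zeroʳ i)) 0≤ij)

square-mono-≤ : ∀ {a b} → 0ℤ ≤ a → a ≤ b → a * a ≤ b * b
square-mono-≤ {a} {b} 0≤a a≤b = ℤ.≤-trans (ℤ.*-monoˡ-≤-nonNeg a a≤b) (ℤ.*-monoʳ-≤-nonNeg b a≤b)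
  where instance
    _ = nonNegative 0≤a
    _ = nonNegative (ℤ.≤-trans 0≤a a≤b)

square≡0⇒≡0 : ∀ {x} → x * x ≡ 0ℤ → x ≡ 0ℤ
square≡0⇒≡0 {x} x²≡0 = reduce (ℤ.i*j≡0⇒i≡0∨j≡0 x x²≡0)

x²+y²≡0⇒x≡0∧y≡0 : ∀ x y → x * x + y * y ≡ 0ℤ → x ≡ 0ℤ × y ≡ 0ℤ
x²+y²≡0⇒x≡0∧y≡0 x y x²+y²≡0 =
  square≡0⇒≡0 (ℤ.≤-antisym (subst (x * x ≤_) x²+y²≡0 (ℤ.i≤i+j (x * x) (y * y))) (square-nonNeg x)) ,
  square≡0⇒≡0 (ℤ.≤-antisym (subst (y * y ≤_) x²+y²≡0 (ℤ.i≤j+i (y * y) (x * x))) (square-nonNeg y))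
  where instance
    _ = nonNegative (square-nonNeg x)
    _ = nonNegative (square-nonNeg y)

-- Gaussian integers

infix 8 -ᵍ_

-ᵍ_ : ℤ[i] → ℤ[i]
-ᵍ (a + b i) = (- a) + (- b) i

1ᵍ : ℤ[i]
1ᵍ = ι 1ℤ

private
  *-assoc-re : ∀ a b c d e f → (a * c - b * d) * e - (a * d + b * c) * f ≡ a * (c * e - d * f) - b * (c * f + d * e)
  *-assoc-re = solve-∀
  *-assoc-im : ∀ a b c d e f → (a * c - b * d) * f + (a * d + b * c) * e ≡ a * (c * f + d * e) + b * (c * e - d * f)
  *-assoc-im = solve-∀
  *-comm-re : ∀ a b c d → a * c - b * d ≡ c * a - d * b
  *-comm-re = solve-∀
  *-comm-im : ∀ a b c d → a * d + b * c ≡ c * b + d * a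
  *-comm-im = solve-∀
  *-identityˡ-re : ∀ a b → 1ℤ * a - 0ℤ * b ≡ a
  *-identityˡ-re = solve-∀
  *-identityˡ-im : ∀ a b → 1ℤ * b + 0ℤ * a ≡ b
  *-identityˡ-im = solve-∀
  *-distribˡ-re : ∀ a b c d e f → a * (c + e) - b * (d + f) ≡ (a * c - b * d) + (a * e - b * f)
  *-distribˡ-re = solve-∀
  *-distribˡ-im : ∀ a b c d e f → a * (d + f) + b * (c + e) ≡ (a * d + b * c) + (a * f + b * e)
  *-distribˡ-im = solve-∀

+ᵍ-assoc : ∀ x y z → x +ᵍ y +ᵍ z ≡ x +ᵍ (y +ᵍ z)
+ᵍ-assoc (a + b i) (c + d i) (e + f i) = cong₂ _+_i (ℤ.+-assoc a c e) (ℤ.+-assoc b d f)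

+ᵍ-comm : ∀ x y → x +ᵍ y ≡ y +ᵍ x
+ᵍ-comm (a + b i) (c + d i) = cong₂ _+_i (ℤ.+-comm a c) (ℤ.+-comm b d)

+ᵍ-identityˡ : ∀ x → 0ᵍ +ᵍ x ≡ x
+ᵍ-identityˡ (a + b i) = cong₂ _+_i (ℤ.+-identityˡ a) (ℤ.+-identityˡ b)

-ᵍ-inverseˡ : ∀ x → -ᵍ x +ᵍ x ≡ 0ᵍ
-ᵍ-inverseˡ (a + b i) = cong₂ _+_i (ℤ.+-inverseˡ a) (ℤ.+-inverseˡ b)

*ᵍ-assoc : ∀ x y z → x *ᵍ y *ᵍ z ≡ x *ᵍ (y *ᵍ z)
*ᵍ-assoc (a + b i) (c + d i) (e + f i) = cong₂ _+_i (*-assoc-re a b c d e f) (*-assoc-im a b c d e f)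

*ᵍ-comm : ∀ x y → x *ᵍ y ≡ y *ᵍ x
*ᵍ-comm (a + b i) (c + d i) = cong₂ _+_i (*-comm-re a b c d) (*-comm-im a b c d)

*ᵍ-identityˡ : ∀ x → 1ᵍ *ᵍ x ≡ x
*ᵍ-identityˡ (a + b i) = cong₂ _+_i (*-identityˡ-re a b) (*-identityˡ-im a b)

*ᵍ-distribˡ-+ᵍ : ∀ x y z → x *ᵍ (y +ᵍ z) ≡ x *ᵍ y +ᵍ x *ᵍ z
*ᵍ-distribˡ-+ᵍ (a + b i) (c + d i) (e + f i) = cong₂ _+_i (*-distribˡ-re a b c d e f) (*-distribˡ-im a b c d e f)

ℤ[i]-isCommutativeRing : IsCommutativeRing _≡_ _+ᵍ_ _*ᵍ_ -ᵍ_ 0ᵍ 1ᵍ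
ℤ[i]-isCommutativeRing = record
  { isRing = record
    { +-isAbelianGroup = record
      { isGroup = record
        { isMonoid = record
          { isSemigroup = record
            { isMagma = record { isEquivalence = isEquivalence ; ∙-cong = cong₂ _+ᵍ_ }
            ; assoc = +ᵍ-assoc
            }
          ; identity = comm∧idˡ⇒id +ᵍ-comm +ᵍ-identityˡ
          }
        ; inverse = comm∧invˡ⇒inv +ᵍ-comm -ᵍ-inverseˡ
        ; ⁻¹-cong = cong -ᵍ_
        }
      ; comm = +ᵍ-comm
      }
    ; *-cong = cong₂ _*ᵍ_
    ; *-assoc = *ᵍ-assoc
    ; *-identity = comm∧idˡ⇒id *ᵍ-comm *ᵍ-identityˡ
    ; distrib = *ᵍ-distribˡ-+ᵍ , comm∧distrˡ⇒distrʳ *ᵍ-comm *ᵍ-distribˡ-+ᵍ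
    }
  ; *-comm = *ᵍ-comm
  }

ℤ[i]-commutativeRing : CommutativeRing _ _
ℤ[i]-commutativeRing = record { isCommutativeRing = ℤ[i]-isCommutativeRing }

open CommutativeRing ℤ[i]-commutativeRing public
  using () renaming (zeroˡ to *ᵍ-zeroˡ; zeroʳ to *ᵍ-zeroʳ; +-identityʳ to +ᵍ-identityʳ)

ℤ[i]-ring : AlmostCommutativeRing _ _
ℤ[i]-ring = fromCommutativeRing ℤ[i]-commutativeRing isZero
  where
  isZero : ∀ x → Maybe (0ᵍ ≡ x)
  isZero (+0 + +0 i) = just refl
  isZero _ = nothing

N : ℤ[i] → ℤ
N (a + b i) = a * a + b * b

private
  conj-*-im : ∀ a b c d → - (a * d + b * c) ≡ a * (- d) + (- b) * c
  conj-*-im = solve-∀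
  conj-*-re : ∀ a b c d → a * c - b * d ≡ a * c - (- b) * (- d)
  conj-*-re = solve-∀
  ι-*-re : ∀ a b → a * b ≡ a * b - 0ℤ * 0ℤ
  ι-*-re = solve-∀
  ι-*-im : ∀ a b → 0ℤ ≡ a * 0ℤ + 0ℤ * b
  ι-*-im = solve-∀
  conj-x*x-re : ∀ a b → a * a - (- b) * b ≡ a * a + b * b
  conj-x*x-re = solve-∀
  conj-x*x-im : ∀ a b → a * b + (- b) * a ≡ 0ℤ
  conj-x*x-im = solve-∀
  N-*-lemma : ∀ a b c d → (a * c - b * d) * (a * c - b * d) + (a * d + b * c) * (a * d + b * c) ≡ (a * a + b * b) * (c * c + d * d)
  N-*-lemma = solve-∀

conj-+ᵍ : ∀ x y → conj (x +ᵍ y) ≡ conj x +ᵍ conj y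
conj-+ᵍ (a + b i) (c + d i) = cong₂ _+_i refl (ℤ.neg-distrib-+ b d)

conj-*ᵍ : ∀ x y → conj (x *ᵍ y) ≡ conj x *ᵍ conj y
conj-*ᵍ (a + b i) (c + d i) = cong₂ _+_i (conj-*-re a b c d) (conj-*-im a b c d)

conj-involutive : ∀ x → conj (conj x) ≡ x
conj-involutive (a + b i) = cong₂ _+_i refl (ℤ.neg-involutive b)

ι-* : ∀ a b → ι (a * b) ≡ ι a *ᵍ ι b
ι-* a b = cong₂ _+_i (ι-*-re a b) (ι-*-im a b)

ι-factor : ∀ s d t F → ι (s * d) *ᵍ t +ᵍ ι s *ᵍ F ≡ ι s *ᵍ (ι d *ᵍ t +ᵍ F)
ι-factor s d t F = trans (cong (λ sd → sd *ᵍ t +ᵍ ι s *ᵍ F) (ι-* s d)) (factor (ι s) (ι d) t F)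
  where
  factor : ∀ S A t F → S *ᵍ A *ᵍ t +ᵍ S *ᵍ F ≡ S *ᵍ (A *ᵍ t +ᵍ F)
  factor = Solver.solve-∀ ℤ[i]-ring

ι-injective : ∀ {a b} → ι a ≡ ι b → a ≡ b
ι-injective = cong re

conj[x]*x≡ι[Nx] : ∀ x → conj x *ᵍ x ≡ ι (N x)
conj[x]*x≡ι[Nx] (a + b i) = cong₂ _+_i (conj-x*x-re a b) (conj-x*x-im a b)

N-* : ∀ x y → N (x *ᵍ y) ≡ N x * N y
N-* (a + b i) (c + d i) = N-*-lemma a b c d

N-ι : ∀ a → N (ι a) ≡ a * a
N-ι a = ℤ.+-identityʳ (a * a)

N-nonNeg : ∀ x → 0ℤ ≤ N x
N-nonNeg (a + b i) = ℤ.+-mono-≤ (square-nonNeg a) (square-nonNeg b)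

N≡0⇒x≡0 : ∀ x → N x ≡ 0ℤ → x ≡ 0ᵍ
N≡0⇒x≡0 (a + b i) a²+b²≡0 = let a≡0 , b≡0 = x²+y²≡0⇒x≡0∧y≡0 a b a²+b²≡0 in cong₂ _+_i a≡0 b≡0

x≢0∧x*y≡0⇒y≡0 : ∀ {x y} → x ≢ 0ᵍ → x *ᵍ y ≡ 0ᵍ → y ≡ 0ᵍ
x≢0∧x*y≡0⇒y≡0 {x} {y} x≢0 xy≡0 with ℤ.i*j≡0⇒i≡0∨j≡0 (N x) (trans (sym (N-* x y)) (cong N xy≡0))
... | inj₁ Nx≡0 = ⊥-elim (x≢0 (N≡0⇒x≡0 x Nx≡0))
... | inj₂ Ny≡0 = N≡0⇒x≡0 y Ny≡0

IsSumOfTwoSquares : ℤ → Set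
IsSumOfTwoSquares l = ∃[ a ] ∃[ b ] l ≡ a * a + b * b

-- q = N (β / t) is a norm from ℚ(i)
IsRationalNorm : ℤ → Set
IsRationalNorm q = ∃[ t ] ∃[ β ] (0ℤ < t × N β ≡ t * t * q)

N-isRationalNorm : ∀ β → IsRationalNorm (N β)
N-isRationalNorm β = 1ℤ , β , +<+ (s≤s z≤n) , sym (ℤ.*-identityˡ (N β))

*-isRationalNorm : ∀ {q r} → IsRationalNorm q → IsRationalNorm r → IsRationalNorm (q * r)
*-isRationalNorm {q} {r} (s , β , s>0 , Nβ≡s²q) (t , γ , t>0 , Nγ≡t²r) =
  s * t , β *ᵍ γ , *-pos s>0 t>0 , (begin
    N (β *ᵍ γ)              ≡⟨ N-* β γ ⟩
    N β * N γ               ≡⟨ cong₂ _*_ Nβ≡s²q Nγ≡t²r ⟩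
    s * s * q * (t * t * r) ≡⟨ rearrange s t q r ⟩
    s * t * (s * t) * (q * r) ∎)
  where
  open ≡-Reasoning
  rearrange : ∀ s t q r → s * s * q * (t * t * r) ≡ s * t * (s * t) * (q * r)
  rearrange = solve-∀

isRationalNorm-cancelˡ : ∀ {a q} → 0ℤ < a → IsRationalNorm (a * a * q) → IsRationalNorm q
isRationalNorm-cancelˡ {a} {q} a>0 (t , β , t>0 , Nβ≡t²a²q) =
  t * a , β , *-pos t>0 a>0 , trans Nβ≡t²a²q (rearrange t a q)
  where
  rearrange : ∀ t a q → t * t * (a * a * q) ≡ t * a * (t * a) * q
  rearrange = solve-∀

square-isRationalNorm : ∀ a → IsRationalNorm (a * a)
square-isRationalNorm a = subst IsRationalNorm (N-ι a) (N-isRationalNorm (ι a))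

isRationalNorm-cancel-common : ∀ {a q r} → 0ℤ < a → IsRationalNorm (a * q) → IsRationalNorm (a * r) → IsRationalNorm (q * r)
isRationalNorm-cancel-common {a} {q} {r} a>0 aq ar =
  isRationalNorm-cancelˡ a>0 (subst IsRationalNorm (regroup a q r) (*-isRationalNorm aq ar))
  where
  regroup : ∀ a q r → a * q * (a * r) ≡ a * a * (q * r)
  regroup = solve-∀

balancedDivMod : ∀ a D → 0ℤ < D → ∃[ x ] ∃[ p ] (a ≡ x * D + p × (p + p) * (p + p) ≤ D * D)
balancedDivMod a +0 (+<+ ())
balancedDivMod a D@(+[1+ d ]) _ =
  balance (a /ℕ suc d) (+ (a %ℕ suc d)) (a≡a%ℕn+[a/ℕn]*n a (suc d)) (+≤+ z≤n) (+<+ (n%ℕd<d a (suc d)))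
  where
  balance : ∀ x r → a ≡ r + x * D → 0ℤ ≤ r → r < D → ∃[ x ] ∃[ p ] (a ≡ x * D + p × (p + p) * (p + p) ≤ D * D)
  balance x r a≡r+xD 0≤r r<D with r + r ℤ.≤? D
  ... | yes 2r≤D = x , r , trans a≡r+xD (ℤ.+-comm r (x * D)) , square-mono-≤ (ℤ.+-mono-≤ 0≤r 0≤r) 2r≤D
  ... | no 2r≰D = x + 1ℤ , r - D , trans a≡r+xD (shift r x D) , subst (_≤ D * D) (flip r D) (square-mono-≤ 0≤s s≤D)
    where
    s = D - r + (D - r)
    shift : ∀ r x D → r + x * D ≡ (x + 1ℤ) * D + (r - D)
    shift = solve-∀
    flip : ∀ r D → (D - r + (D - r)) * (D - r + (D - r)) ≡ (r - D + (r - D)) * (r - D + (r - D))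
    flip = solve-∀
    s≡D-[2r-D] : ∀ r D → D - r + (D - r) ≡ D - (r + r - D)
    s≡D-[2r-D] = solve-∀
    0≤s : 0ℤ ≤ s
    0≤s = ℤ.+-mono-≤ 0≤D-r 0≤D-r
      where 0≤D-r = ℤ.i≤j⇒0≤j-i (ℤ.<⇒≤ r<D)
    s≤D : s ≤ D
    s≤D = subst (_≤ D) (sym (s≡D-[2r-D] r D))
      (ℤ.i-j≤i D (r + r - D) {{nonNegative (ℤ.i≤j⇒0≤j-i (ℤ.<⇒≤ (ℤ.≰⇒> 2r≰D)))}})

-- Davenport–Cassels descent. Let (a, b) = D (x, y) + (p, q) lie on the circle X² + Y² = l D², with p, q small.
-- The line through the lattice point w = (x, y) and (a, b) / D meets the circle X² + Y² = l again at
-- (E w + K (p, q)) / E, where K = x² + y² − l and E = (p² + q²) / D ≤ D / 2.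

cofactor : (l D x y p q : ℤ) → ℤ
cofactor l D x y p q = l * D - D * (x * x + y * y) - (x * p + y * q) - (x * p + y * q)

cofactor-* : ∀ l D x y p q → (x * D + p) * (x * D + p) + (y * D + q) * (y * D + q) ≡ l * (D * D) →
             D * cofactor l D x y p q ≡ p * p + q * q
cofactor-* l D x y p q a²+b²≡lD² = begin
  D * cofactor l D x y p q
    ≡⟨ expand l D x y p q ⟩
  l * (D * D) - ((x * D + p) * (x * D + p) + (y * D + q) * (y * D + q)) + r²
    ≡⟨ cong (λ n → l * (D * D) - n + r²) a²+b²≡lD² ⟩
  l * (D * D) - l * (D * D) + r²
    ≡⟨ cancel (l * (D * D)) r² ⟩
  r²
    ∎
  where
  open ≡-Reasoning
  r² = p * p + q * q
  expand : ∀ l D x y p q → D * (l * D - D * (x * x + y * y) - (x * p + y * q) - (x * p + y * q))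
    ≡ l * (D * D) - ((x * D + p) * (x * D + p) + (y * D + q) * (y * D + q)) + (p * p + q * q)
  expand = solve-∀
  cancel : ∀ m n → m - m + n ≡ n
  cancel = solve-∀

second-point : ∀ l D x y p q → (x * D + p) * (x * D + p) + (y * D + q) * (y * D + q) ≡ l * (D * D) →
  let E = cofactor l D x y p q
      K = x * x + y * y - l
  in (E * x + K * p) * (E * x + K * p) + (E * y + K * q) * (E * y + K * q) ≡ l * (E * E)
second-point l D x y p q a²+b²≡lD² = begin
  (E * x + K * p) * (E * x + K * p) + (E * y + K * q) * (E * y + K * q)
    ≡⟨ expand l D x y p q ⟩
  l * (E * E) + K * K * ((x * D + p) * (x * D + p) + (y * D + q) * (y * D + q) - l * (D * D))
    ≡⟨ cong (λ n → l * (E * E) + K * K * (n - l * (D * D))) a²+b²≡lD² ⟩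
  l * (E * E) + K * K * (l * (D * D) - l * (D * D))
    ≡⟨ cancel (l * (E * E)) (K * K) (l * (D * D)) ⟩
  l * (E * E)
    ∎
  where
  open ≡-Reasoning
  E = cofactor l D x y p q
  K = x * x + y * y - l
  expand : ∀ l D x y p q → let E = l * D - D * (x * x + y * y) - (x * p + y * q) - (x * p + y * q)
                               K = x * x + y * y - l in
    (E * x + K * p) * (E * x + K * p) + (E * y + K * q) * (E * y + K * q)
    ≡ l * (E * E) + K * K * ((x * D + p) * (x * D + p) + (y * D + q) * (y * D + q) - l * (D * D))
  expand = solve-∀
  cancel : ∀ m k n → m + k * (n - n) ≡ m
  cancel = solve-∀

cofactor-≤-half : ∀ {D E} p q → 0ℤ < D → D * E ≡ p * p + q * q →
                  (p + p) * (p + p) ≤ D * D → (q + q) * (q + q) ≤ D * D → E + E ≤ D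
cofactor-≤-half {D} {E} p q D>0 DE≡p²+q² p-small q-small =
  ℤ.*-cancelˡ-≤-pos (E + E) D D {{positive D>0}}
    (ℤ.*-cancelˡ-≤-pos (D * (E + E)) (D * D) (+ 2) (begin
      + 2 * (D * (E + E))                   ≡⟨ quadruple D E ⟩
      + 4 * (D * E)                         ≡⟨ cong (+ 4 *_) DE≡p²+q² ⟩
      + 4 * (p * p + q * q)                 ≡⟨ expand p q ⟩
      (p + p) * (p + p) + (q + q) * (q + q) ≤⟨ ℤ.+-mono-≤ p-small q-small ⟩
      D * D + D * D                         ≡⟨ twice (D * D) ⟩
      + 2 * (D * D)                         ∎))
  where
  open ℤ.≤-Reasoning
  quadruple : ∀ D E → + 2 * (D * (E + E)) ≡ + 4 * (D * E)
  quadruple = solve-∀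
  expand : ∀ p q → + 4 * (p * p + q * q) ≡ (p + p) * (p + p) + (q + q) * (q + q)
  expand = solve-∀
  twice : ∀ n → n + n ≡ + 2 * n
  twice = solve-∀

descent-step : ∀ l D a b → 0ℤ < D → a * a + b * b ≡ l * (D * D) →
               IsSumOfTwoSquares l ⊎ ∃[ E ] ∃[ a′ ] ∃[ b′ ] (0ℤ < E × E < D × a′ * a′ + b′ * b′ ≡ l * (E * E))
descent-step l D a b D>0 a²+b²≡lD² with balancedDivMod a D D>0 | balancedDivMod b D D>0
... | x , p , refl , p-small | y , q , refl , q-small = conclude (E ℤ.≟ 0ℤ)
  where
  E = cofactor l D x y p q
  DE≡p²+q² = cofactor-* l D x y p q a²+b²≡lD²

  conclude : Dec (E ≡ 0ℤ) →
             IsSumOfTwoSquares l ⊎ ∃[ E ] ∃[ a′ ] ∃[ b′ ] (0ℤ < E × E < D × a′ * a′ + b′ * b′ ≡ l * (E * E))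
  conclude (yes E≡0) = inj₁ (x , y , sym (ℤ.*-cancelʳ-≡ (x * x + y * y) l (D * D) {{>-nonZero (*-pos D>0 D>0)}}
    (scale x y D ⟨ trans ⟩
     cong₂ (λ p q → (x * D + p) * (x * D + p) + (y * D + q) * (y * D + q)) (sym p≡0) (sym q≡0) ⟨ trans ⟩
     a²+b²≡lD²)))
    where
    p≡0×q≡0 = x²+y²≡0⇒x≡0∧y≡0 p q (sym DE≡p²+q² ⟨ trans ⟩ cong (D *_) E≡0 ⟨ trans ⟩ ℤ.*-zeroʳ D)
    p≡0 = proj₁ p≡0×q≡0
    q≡0 = proj₂ p≡0×q≡0
    scale : ∀ x y D → (x * x + y * y) * (D * D) ≡ (x * D + 0ℤ) * (x * D + 0ℤ) + (y * D + 0ℤ) * (y * D + 0ℤ)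
    scale = solve-∀
  conclude (no E≢0) = inj₂ (E , E * x + K * p , E * y + K * q , E>0 , E<D , second-point l D x y p q a²+b²≡lD²)
    where
    K = x * x + y * y - l
    E>0 : 0ℤ < E
    E>0 = ℤ.≤∧≢⇒< (0<i∧0≤i*j⇒0≤j D>0 (subst (0ℤ ≤_) (sym DE≡p²+q²) (N-nonNeg (p + q i)))) (E≢0 ∘ sym)
    E<D : E < D
    E<D = ℤ.<-≤-trans (subst (_< E + E) (ℤ.+-identityʳ E) (ℤ.+-monoʳ-< E E>0))
                      (cofactor-≤-half p q D>0 DE≡p²+q² p-small q-small)

isRationalNorm⇒isSumOfTwoSquares : ∀ {l} → IsRationalNorm l → IsSumOfTwoSquares l
isRationalNorm⇒isSumOfTwoSquares (+0 , _ , +<+ () , _)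
isRationalNorm⇒isSumOfTwoSquares {l} (+[1+ d ] , a + b i , _ , a²+b²≡t²l) =
  <-rec P descend d a b (trans a²+b²≡t²l (ℤ.*-comm _ l))
  where
  P : ℕ → Set
  P d = ∀ a b → a * a + b * b ≡ l * (+[1+ d ] * +[1+ d ]) → IsSumOfTwoSquares l
  descend : ∀ d → (∀ {e} → e ℕ.< d → P e) → P d
  descend d recurse a b a²+b²≡lD² with descent-step l +[1+ d ] a b (+<+ (s≤s z≤n)) a²+b²≡lD²
  ... | inj₁ l≡x²+y² = l≡x²+y²
  ... | inj₂ (+0 , _ , _ , +<+ () , _)
  ... | inj₂ (+[1+ e ] , a′ , b′ , _ , E<D , a′²+b′²≡lE²) =
    recurse (s≤s⁻¹ (ℤ.drop‿+<+ E<D)) a′ b′ a′²+b′²≡lE²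

-- Diagonal Hermitian forms and similitudes

∏-const : ∀ n c → ∏ {n} (λ _ → c) ≡ c ^ n
∏-const zero c = refl
∏-const (suc n) c = cong (c *_) (∏-const n c)

∏-scale : ∀ {n} c (f : Vector ℤ n) → ∏ (λ k → c * f k) ≡ c ^ n * ∏ f
∏-scale {n} c f = trans (∏-distrib-* (λ _ → c) f) (cong (_* ∏ f) (∏-const n c))

∏-pos : ∀ {n} (f : Vector ℤ n) → (∀ k → 0ℤ < f k) → 0ℤ < ∏ f
∏-pos {zero} f f>0 = +<+ (s≤s z≤n)
∏-pos {suc n} f f>0 = *-pos (f>0 zero) (∏-pos (tail f) (f>0 ∘ suc))

form : ∀ {n} → Vector ℤ n → Vector ℤ[i] n → Vector ℤ[i] n → ℤ[i]
form {n} D u w = Σᵍ n (λ k → ι (D k) *ᵍ (conj (u k) *ᵍ w k))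

record IsOrthogonalFamily {n m} (D : Vector ℤ n) (E : Vector ℤ m) (V : Vector (Vector ℤ[i] n) m) : Set where
  constructor orthogonalFamily
  field
    norm : ∀ k → form D (V k) (V k) ≡ ι (E k)
    orthogonal : ∀ k l → k ≢ l → form D (V k) (V l) ≡ 0ᵍ

form-ones : ∀ {n} (u w : Vector ℤ[i] n) → form (λ _ → 1ℤ) u w ≡ u *· w
form-ones {zero} u w = refl
form-ones {suc n} u w = cong₂ _+ᵍ_ (*ᵍ-identityˡ (conj (u zero) *ᵍ w zero)) (form-ones (tail u) (tail w))

form-scale : ∀ {n} s (D : Vector ℤ n) u w → form (λ k → s * D k) u w ≡ ι s *ᵍ form D u w
form-scale {zero} s D u w = sym (*ᵍ-zeroʳ (ι s))
form-scale {suc n} s D u w =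
  trans (cong (ι (s * D zero) *ᵍ (conj (u zero) *ᵍ w zero) +ᵍ_) (form-scale s (tail D) (tail u) (tail w)))
        (ι-factor s (D zero) _ _)

private
  term-zeroˡ : ∀ d {u} w → u ≡ 0ᵍ → ι d *ᵍ (conj u *ᵍ w) ≡ 0ᵍ
  term-zeroˡ d w refl = trans (cong (ι d *ᵍ_) (*ᵍ-zeroˡ w)) (*ᵍ-zeroʳ (ι d))

form-zeroˡ : ∀ {n} (D : Vector ℤ n) u w → (∀ k → u k ≡ 0ᵍ) → form D u w ≡ 0ᵍ
form-zeroˡ {zero} D u w u≡0 = refl
form-zeroˡ {suc n} D u w u≡0 =
  cong₂ _+ᵍ_ (term-zeroˡ (D zero) (w zero) (u≡0 zero)) (form-zeroˡ (tail D) (tail u) (tail w) (u≡0 ∘ suc))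

form-headZero : ∀ {n} (D : Vector ℤ (suc n)) u w → u zero ≡ 0ᵍ → form D u w ≡ form (tail D) (tail u) (tail w)
form-headZero D u w u₀≡0 =
  trans (cong (_+ᵍ form (tail D) (tail u) (tail w)) (term-zeroˡ (D zero) (w zero) u₀≡0)) (+ᵍ-identityˡ _)

OnFirstAxis : ∀ {n} → Vector ℤ[i] (suc n) → Set
OnFirstAxis u = ∀ k → u (suc k) ≡ 0ᵍ

form-onFirstAxis : ∀ {n} (D : Vector ℤ (suc n)) u w → OnFirstAxis u → form D u w ≡ ι (D zero) *ᵍ (conj (u zero) *ᵍ w zero)
form-onFirstAxis D u w u-axial =
  trans (cong (ι (D zero) *ᵍ (conj (u zero) *ᵍ w zero) +ᵍ_) (form-zeroˡ (tail D) (tail u) (tail w) u-axial)) (+ᵍ-identityʳ _)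

-- If P is the matrix of φ then φ-form says P* D′ P = c D, so ∏ D′ · cⁿ · ∏ D = N (det P · ∏ D′) is a norm;
-- the field discriminant keeps just this consequence of taking determinants.
record Similitude {n} (D : Vector ℤ n) : Set where
  field
    D′ : Vector ℤ n
    D′-pos : ∀ k → 0ℤ < D′ k
    c : ℤ
    c-pos : 0ℤ < c
    φ : Vector ℤ[i] n → Vector ℤ[i] n
    φ-form : ∀ u w → form D′ (φ u) (φ w) ≡ ι c *ᵍ form D u w
    discriminant : IsRationalNorm (∏ D′ * c ^ n * ∏ D)

similitude-id : ∀ {n} {D : Vector ℤ n} → (∀ k → 0ℤ < D k) → Similitude D
similitude-id {n} {D} D>0 = record
  { D′ = D
  ; D′-pos = D>0
  ; c = 1ℤ
  ; c-pos = +<+ (s≤s z≤n)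
  ; φ = λ u → u
  ; φ-form = λ u w → sym (*ᵍ-identityˡ (form D u w))
  ; discriminant = subst IsRationalNorm (sym ∏D*1ⁿ*∏D≡∏D²) (square-isRationalNorm (∏ D))
  }
  where
  ∏D*1ⁿ*∏D≡∏D² : ∏ D * 1ℤ ^ n * ∏ D ≡ ∏ D * ∏ D
  ∏D*1ⁿ*∏D≡∏D² = cong (λ e → ∏ D * e * ∏ D) (ℤ.^-zeroˡ n) ⟨ trans ⟩ cong (_* ∏ D) (ℤ.*-identityʳ (∏ D))

similitude-extend : ∀ {n} {D : Vector ℤ (suc n)} → 0ℤ < D zero → Similitude (tail D) → Similitude D
similitude-extend {n} {D} D₀>0 T = record
  { D′ = c * D zero ∷ D′
  ; D′-pos = λ { zero → *-pos c-pos D₀>0 ; (suc k) → D′-pos k }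
  ; c = c
  ; c-pos = c-pos
  ; φ = λ u → head u ∷ φ (tail u)
  ; φ-form = λ u w → trans (cong (ι (c * D zero) *ᵍ (conj (u zero) *ᵍ w zero) +ᵍ_) (φ-form (tail u) (tail w)))
                           (ι-factor c (D zero) _ _)
  ; discriminant = subst IsRationalNorm (regroup c (D zero) (∏ D′) (c ^ n) (∏ (tail D)))
                     (*-isRationalNorm (square-isRationalNorm (c * D zero)) discriminant)
  }
  where
  open Similitude T
  regroup : ∀ c d P′ q P → c * d * (c * d) * (P′ * q * P) ≡ c * d * P′ * (c * q) * (d * P)
  regroup = solve-∀

similitude-∘ : ∀ {n} {D : Vector ℤ n} (T : Similitude D) → Similitude (Similitude.D′ T) → Similitude D
similitude-∘ {n} {D} T U = record
  { D′ = U.D′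
  ; D′-pos = U.D′-pos
  ; c = T.c * U.c
  ; c-pos = *-pos T.c-pos U.c-pos
  ; φ = U.φ ∘ T.φ
  ; φ-form = λ u w → begin
      form U.D′ (U.φ (T.φ u)) (U.φ (T.φ w)) ≡⟨ U.φ-form (T.φ u) (T.φ w) ⟩
      ι U.c *ᵍ form T.D′ (T.φ u) (T.φ w)    ≡⟨ cong (ι U.c *ᵍ_) (T.φ-form u w) ⟩
      ι U.c *ᵍ (ι T.c *ᵍ form D u w)        ≡⟨ swap (ι U.c) (ι T.c) (form D u w) ⟩
      ι T.c *ᵍ ι U.c *ᵍ form D u w          ≡⟨ cong (_*ᵍ form D u w) (ι-* T.c U.c) ⟨
      ι (T.c * U.c) *ᵍ form D u w           ∎
  ; discriminant = subst IsRationalNorm regroup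
      (isRationalNorm-cancel-common (∏-pos T.D′ T.D′-pos)
        (subst IsRationalNorm (ℤ.*-comm (∏ U.D′ * U.c ^ n) (∏ T.D′)) U.discriminant)
        (subst IsRationalNorm (ℤ.*-assoc (∏ T.D′) (T.c ^ n) (∏ D)) T.discriminant))
  }
  where
  module T = Similitude T
  module U = Similitude U
  open ≡-Reasoning
  swap : ∀ x y z → x *ᵍ (y *ᵍ z) ≡ y *ᵍ x *ᵍ z
  swap = Solver.solve-∀ ℤ[i]-ring
  regroup : ∏ U.D′ * U.c ^ n * (T.c ^ n * ∏ D) ≡ ∏ U.D′ * (T.c * U.c) ^ n * ∏ D
  regroup = merge (∏ U.D′) (U.c ^ n) (T.c ^ n) (∏ D) ⟨ trans ⟩ cong (λ e → ∏ U.D′ * e * ∏ D) (sym (^-distribʳ-* T.c U.c n))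
    where
    merge : ∀ P″ p q P → P″ * p * (q * P) ≡ P″ * (q * p) * P
    merge = solve-∀

-- On the first two coordinates φ is (u₀, u₁) ↦ (a x̄ u₀ + b ȳ u₁, x u₁ − y u₀), which sends (x, y) to (s, 0).
rotation : ∀ {n} (D : Vector ℤ (suc (suc n))) → (∀ k → 0ℤ < D k) → (x y : ℤ[i]) → 0ℤ < N y → Similitude D
rotation {n} D D>0 x y Ny>0 = record
  { D′ = D′
  ; D′-pos = λ { zero → +<+ (s≤s z≤n) ; (suc zero) → *-pos a>0 b>0 ; (suc (suc k)) → *-pos s>0 (D>0 (suc (suc k))) }
  ; c = s
  ; c-pos = s>0
  ; φ = φ
  ; φ-form = φ-form
  ; discriminant = subst IsRationalNorm (sym ∏D′sⁿ⁺²∏D≡square) (square-isRationalNorm (a * b * (s * s ^ n) * ∏ Dᵣ))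
  }
  where
  a = D zero
  b = D (suc zero)
  a>0 = D>0 zero
  b>0 = D>0 (suc zero)
  Dᵣ = tail (tail D)
  s = a * N x + b * N y
  s>0 : 0ℤ < s
  s>0 = ℤ.+-mono-≤-< (*-nonNeg (ℤ.<⇒≤ a>0) (N-nonNeg x)) (*-pos b>0 Ny>0)

  D′ : Vector ℤ (suc (suc n))
  D′ = 1ℤ ∷ a * b ∷ (λ k → s * Dᵣ k)

  φ : Vector ℤ[i] (suc (suc n)) → Vector ℤ[i] (suc (suc n))
  φ u = ι a *ᵍ conj x *ᵍ u zero +ᵍ ι b *ᵍ conj y *ᵍ u (suc zero)
      ∷ -ᵍ y *ᵍ u zero +ᵍ x *ᵍ u (suc zero)
      ∷ tail (tail u)

  ∏D′sⁿ⁺²∏D≡square : ∏ D′ * s ^ suc (suc n) * ∏ D ≡ a * b * (s * s ^ n) * ∏ Dᵣ * (a * b * (s * s ^ n) * ∏ Dᵣ)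
  ∏D′sⁿ⁺²∏D≡square =
    cong (λ p → 1ℤ * (a * b * p) * (s * (s * s ^ n)) * (a * (b * ∏ Dᵣ))) (∏-scale s Dᵣ) ⟨ trans ⟩
    regroup a b s (s ^ n) (∏ Dᵣ)
    where
    regroup : ∀ a b s q P → 1ℤ * (a * b * (q * P)) * (s * (s * q)) * (a * (b * P))
                          ≡ a * b * (s * q) * P * (a * b * (s * q) * P)
    regroup = solve-∀

  ι-s : ι s ≡ ι a *ᵍ (conj x *ᵍ x) +ᵍ ι b *ᵍ (conj y *ᵍ y)
  ι-s = cong₂ _+ᵍ_ (ι-* a (N x) ⟨ trans ⟩ cong (ι a *ᵍ_) (sym (conj[x]*x≡ι[Nx] x)))
                  (ι-* b (N y) ⟨ trans ⟩ cong (ι b *ᵍ_) (sym (conj[x]*x≡ι[Nx] y)))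

  conj-φ₀ : ∀ u → conj (φ u zero) ≡ ι a *ᵍ x *ᵍ conj (u zero) +ᵍ ι b *ᵍ y *ᵍ conj (u (suc zero))
  conj-φ₀ u = conj-+ᵍ (ι a *ᵍ conj x *ᵍ u zero) (ι b *ᵍ conj y *ᵍ u (suc zero)) ⟨ trans ⟩
              cong₂ _+ᵍ_ (conj-term a x (u zero)) (conj-term b y (u (suc zero)))
    where
    conj-term : ∀ d z v → conj (ι d *ᵍ conj z *ᵍ v) ≡ ι d *ᵍ z *ᵍ conj v
    conj-term d z v = conj-*ᵍ (ι d *ᵍ conj z) v ⟨ trans ⟩
                      cong (_*ᵍ conj v) (conj-*ᵍ (ι d) (conj z) ⟨ trans ⟩ cong (ι d *ᵍ_) (conj-involutive z))

  conj-φ₁ : ∀ u → conj (φ u (suc zero)) ≡ -ᵍ conj y *ᵍ conj (u zero) +ᵍ conj x *ᵍ conj (u (suc zero))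
  conj-φ₁ u = conj-+ᵍ (-ᵍ y *ᵍ u zero) (x *ᵍ u (suc zero)) ⟨ trans ⟩
              cong₂ _+ᵍ_ (conj-*ᵍ (-ᵍ y) (u zero)) (conj-*ᵍ x (u (suc zero)))

  rotation-identity : ∀ A B x X y Y U₀ U₁ w₀ w₁ F →
    (A *ᵍ x *ᵍ U₀ +ᵍ B *ᵍ y *ᵍ U₁) *ᵍ (A *ᵍ X *ᵍ w₀ +ᵍ B *ᵍ Y *ᵍ w₁) +ᵍ
      (A *ᵍ B *ᵍ ((-ᵍ Y *ᵍ U₀ +ᵍ X *ᵍ U₁) *ᵍ (-ᵍ y *ᵍ w₀ +ᵍ x *ᵍ w₁)) +ᵍ (A *ᵍ (X *ᵍ x) +ᵍ B *ᵍ (Y *ᵍ y)) *ᵍ F)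
    ≡ (A *ᵍ (X *ᵍ x) +ᵍ B *ᵍ (Y *ᵍ y)) *ᵍ (A *ᵍ (U₀ *ᵍ w₀) +ᵍ (B *ᵍ (U₁ *ᵍ w₁) +ᵍ F))
  rotation-identity = Solver.solve-∀ ℤ[i]-ring

  φ-form : ∀ u w → form D′ (φ u) (φ w) ≡ ι s *ᵍ form D u w
  φ-form u w = begin
    ι 1ℤ *ᵍ (conj (φ u zero) *ᵍ φ w zero) +ᵍ
      (ι (a * b) *ᵍ (conj (φ u (suc zero)) *ᵍ φ w (suc zero)) +ᵍ form (λ k → s * Dᵣ k) uᵣ wᵣ)
      ≡⟨ cong₂ _+ᵍ_ (*ᵍ-identityˡ _ ⟨ trans ⟩ cong (_*ᵍ φ w zero) (conj-φ₀ u))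
                    (cong₂ _+ᵍ_ (cong₂ _*ᵍ_ (ι-* a b) (cong (_*ᵍ φ w (suc zero)) (conj-φ₁ u)))
                                (form-scale s Dᵣ uᵣ wᵣ ⟨ trans ⟩ cong (_*ᵍ F) ι-s)) ⟩
    (A *ᵍ x *ᵍ U₀ +ᵍ B *ᵍ y *ᵍ U₁) *ᵍ φ w zero +ᵍ
      (A *ᵍ B *ᵍ ((-ᵍ conj y *ᵍ U₀ +ᵍ conj x *ᵍ U₁) *ᵍ φ w (suc zero)) +ᵍ
        (A *ᵍ (conj x *ᵍ x) +ᵍ B *ᵍ (conj y *ᵍ y)) *ᵍ F)
      ≡⟨ rotation-identity A B x (conj x) y (conj y) U₀ U₁ (w zero) (w (suc zero)) F ⟩
    (A *ᵍ (conj x *ᵍ x) +ᵍ B *ᵍ (conj y *ᵍ y)) *ᵍ form D u w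
      ≡⟨ cong (_*ᵍ form D u w) ι-s ⟨
    ι s *ᵍ form D u w
      ∎
    where
    open ≡-Reasoning
    A = ι a
    B = ι b
    U₀ = conj (u zero)
    U₁ = conj (u (suc zero))
    uᵣ = tail (tail u)
    wᵣ = tail (tail w)
    F = form Dᵣ uᵣ wᵣ

rotation-clears : ∀ {n} (D : Vector ℤ (suc (suc n))) D>0 x y Ny>0 (u : Vector ℤ[i] (suc (suc n))) →
                  u zero ≡ x → u (suc zero) ≡ y → Similitude.φ (rotation D D>0 x y Ny>0) u (suc zero) ≡ 0ᵍ
rotation-clears D D>0 x y Ny>0 u refl refl = cancel x y
  where
  cancel : ∀ x y → -ᵍ y *ᵍ x +ᵍ x *ᵍ y ≡ 0ᵍ
  cancel = Solver.solve-∀ ℤ[i]-ring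

eliminate : ∀ {n} (D : Vector ℤ (suc n)) → (∀ k → 0ℤ < D k) → (v : Vector ℤ[i] (suc n)) →
            Σ (Similitude D) (λ T → OnFirstAxis (Similitude.φ T v))
eliminate {zero} D D>0 v = similitude-id D>0 , λ ()
eliminate {suc n} D D>0 v = extend-and-rotate (eliminate (tail D) (D>0 ∘ suc) (tail v))
  where
  extend-and-rotate : Σ (Similitude (tail D)) (λ T → OnFirstAxis (Similitude.φ T (tail v))) →
                      Σ (Similitude D) (λ T → OnFirstAxis (Similitude.φ T v))
  extend-and-rotate (T , T-axial) = rotate-if-needed (N y ℤ.≟ 0ℤ)
    where
    L = similitude-extend (D>0 zero) T
    y = Similitude.φ L v (suc zero)
    rotate-if-needed : Dec (N y ≡ 0ℤ) → Σ (Similitude D) (λ T → OnFirstAxis (Similitude.φ T v))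
    rotate-if-needed (yes Ny≡0) = L , λ { zero → N≡0⇒x≡0 y Ny≡0 ; (suc k) → T-axial k }
    rotate-if-needed (no Ny≢0) = similitude-∘ L R , λ { zero → R-clears ; (suc k) → T-axial k }
      where
      open Similitude L using (D′; D′-pos; φ)
      Ny>0 = ℤ.≤∧≢⇒< (N-nonNeg y) (Ny≢0 ∘ sym)
      R = rotation D′ D′-pos (v zero) y Ny>0
      R-clears = rotation-clears D′ D′-pos (v zero) y Ny>0 (φ v) refl refl

similitude-orthogonalFamily : ∀ {n k} {D : Vector ℤ n} {E : Vector ℤ k} {V} (T : Similitude D) →
  IsOrthogonalFamily D E V → IsOrthogonalFamily (Similitude.D′ T) (λ k → Similitude.c T * E k) (Similitude.φ T ∘ V)
similitude-orthogonalFamily {E = E} {V} T (orthogonalFamily norm orthogonal) = orthogonalFamily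
  (λ k → φ-form (V k) (V k) ⟨ trans ⟩ cong (ι c *ᵍ_) (norm k) ⟨ trans ⟩ sym (ι-* c (E k)))
  (λ k l k≢l → φ-form (V k) (V l) ⟨ trans ⟩ cong (ι c *ᵍ_) (orthogonal k l k≢l) ⟨ trans ⟩ *ᵍ-zeroʳ (ι c))
  where open Similitude T

orthogonalFamily-split : ∀ {n} {D E : Vector ℤ (suc n)} {W} → 0ℤ < D zero → 0ℤ < E zero →
  IsOrthogonalFamily D E W → OnFirstAxis (W zero) →
  D zero * N (W zero zero) ≡ E zero × IsOrthogonalFamily (tail D) (tail E) (λ k → tail (W (suc k)))
orthogonalFamily-split {n} {D} {E} {W} D₀>0 E₀>0 (orthogonalFamily norm orthogonal) W₀-axial =
  dNβ≡E₀ , orthogonalFamily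
    (λ k → sym (form-headZero D (W (suc k)) (W (suc k)) (first-coordinate-zero k)) ⟨ trans ⟩ norm (suc k))
    (λ k l k≢l → sym (form-headZero D (W (suc k)) (W (suc l)) (first-coordinate-zero k)) ⟨ trans ⟩
                 orthogonal (suc k) (suc l) (k≢l ∘ suc-injective))
  where
  d = D zero
  β = W zero zero
  first-row : ∀ w → form D (W zero) w ≡ ι d *ᵍ (conj β *ᵍ w zero)
  first-row w = form-onFirstAxis D (W zero) w W₀-axial
  dNβ≡E₀ : d * N β ≡ E zero
  dNβ≡E₀ = ι-injective (begin
    ι (d * N β)                ≡⟨ ι-* d (N β) ⟩
    ι d *ᵍ ι (N β)             ≡⟨ cong (ι d *ᵍ_) (conj[x]*x≡ι[Nx] β) ⟨
    ι d *ᵍ (conj β *ᵍ β)       ≡⟨ first-row (W zero) ⟨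
    form D (W zero) (W zero)   ≡⟨ norm zero ⟩
    ι (E zero)                 ∎)
    where open ≡-Reasoning
  ιd≢0 : ι d ≢ 0ᵍ
  ιd≢0 ιd≡0 = ℤ.<⇒≢ D₀>0 (sym (cong re ιd≡0))
  conjβ≢0 : conj β ≢ 0ᵍ
  conjβ≢0 conjβ≡0 = ℤ.<⇒≢ E₀>0 (sym (ℤ.*-zeroʳ d) ⟨ trans ⟩ cong (λ z → d * N z) (sym β≡0) ⟨ trans ⟩ dNβ≡E₀)
    where
    β≡0 : β ≡ 0ᵍ
    β≡0 = sym (conj-involutive β) ⟨ trans ⟩ cong conj conjβ≡0
  first-coordinate-zero : ∀ k → W (suc k) zero ≡ 0ᵍ
  first-coordinate-zero k = x≢0∧x*y≡0⇒y≡0 conjβ≢0 (x≢0∧x*y≡0⇒y≡0 ιd≢0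
    (sym (first-row (W (suc k))) ⟨ trans ⟩ orthogonal zero (suc k) λ ()))

orthogonalFamily⇒isRationalNorm : ∀ {n} {D E : Vector ℤ n} {V : Vector (Vector ℤ[i] n) n} →
  (∀ k → 0ℤ < D k) → (∀ k → 0ℤ < E k) → IsOrthogonalFamily D E V → IsRationalNorm (∏ D * ∏ E)
orthogonalFamily⇒isRationalNorm {zero} _ _ _ = N-isRationalNorm 1ᵍ
orthogonalFamily⇒isRationalNorm {suc n} {D} {E} {V} D>0 E>0 V-orthogonal = reduce-to-tail (eliminate D D>0 (V zero))
  where
  reduce-to-tail : Σ (Similitude D) (λ T → OnFirstAxis (Similitude.φ T (V zero))) → IsRationalNorm (∏ D * ∏ E)
  reduce-to-tail (T , W₀-axial) =
    isRationalNorm-cancel-common (*-pos (∏-pos D′ D′-pos) (^-pos (suc n) c-pos)) discriminant ∏D′cⁿ∏E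
    where
    open Similitude T
    cE>0 : ∀ k → 0ℤ < c * E k
    cE>0 k = *-pos c-pos (E>0 k)
    d = D′ zero
    β = φ (V zero) zero
    split : d * N β ≡ c * E zero × IsOrthogonalFamily (tail D′) (λ k → c * E (suc k)) (λ k → tail (φ (V (suc k))))
    split = orthogonalFamily-split (D′-pos zero) (cE>0 zero) (similitude-orthogonalFamily T V-orthogonal) W₀-axial
    head-part : IsRationalNorm (d * (c * E zero))
    head-part = subst IsRationalNorm (ℤ.*-assoc d d (N β) ⟨ trans ⟩ cong (d *_) (proj₁ split))
                  (*-isRationalNorm (square-isRationalNorm d) (N-isRationalNorm β))
    tail-part : IsRationalNorm (∏ (tail D′) * ∏ (λ k → c * E (suc k)))
    tail-part = orthogonalFamily⇒isRationalNorm (D′-pos ∘ suc) (cE>0 ∘ suc) (proj₂ split)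
    ∏D′cⁿ∏E : IsRationalNorm (∏ D′ * c ^ suc n * ∏ E)
    ∏D′cⁿ∏E = subst IsRationalNorm (interchange d (c * E zero) (∏ (tail D′)) (∏ (λ k → c * E (suc k))) ⟨ trans ⟩
                                    cong (∏ D′ *_) (∏-scale c E) ⟨ trans ⟩ sym (ℤ.*-assoc (∏ D′) (c ^ suc n) (∏ E)))
                (*-isRationalNorm head-part tail-part)
      where
      interchange : ∀ a b c d → a * b * (c * d) ≡ a * c * (b * d)
      interchange = solve-∀

isIcube⇒isOrthogonalFamily : ∀ {n m λ'} (M : Matrix n m) → IsIcube n m λ' M →
                             IsOrthogonalFamily (λ _ → 1ℤ) (λ _ → λ') (col M)
isIcube⇒isOrthogonalFamily M (norm , orthogonal) = orthogonalFamily
  (λ k → form-ones (col M k) (col M k) ⟨ trans ⟩ norm k)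
  (λ k l k≢l → form-ones (col M k) (col M l) ⟨ trans ⟩ orthogonal k l k≢l)

icube⇒λ^n-isRationalNorm : ∀ {n λ'} (M : Matrix n n) → 0ℤ < λ' → IsIcube n n λ' M → IsRationalNorm (λ' ^ n)
icube⇒λ^n-isRationalNorm {n} {λ'} M λ'>0 M-icube =
  subst IsRationalNorm (cong₂ _*_ (∏-const n 1ℤ ⟨ trans ⟩ ℤ.^-zeroˡ n) (∏-const n λ') ⟨ trans ⟩
                        ℤ.*-identityˡ (λ' ^ n))
    (orthogonalFamily⇒isRationalNorm (λ _ → +<+ (s≤s z≤n)) (λ _ → λ'>0) (isIcube⇒isOrthogonalFamily M M-icube))

odd-power⇒isRationalNorm : ∀ {a} m → 0ℤ < a → IsRationalNorm (a ^ suc (2 *ℕ m)) → IsRationalNorm a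
odd-power⇒isRationalNorm {a} m a>0 a²ᵐ⁺¹ =
  isRationalNorm-cancelˡ (^-pos m a>0) (subst IsRationalNorm a²ᵐ⁺¹≡aᵐaᵐa a²ᵐ⁺¹)
  where
  a²ᵐ⁺¹≡aᵐaᵐa : a ^ suc (2 *ℕ m) ≡ a ^ m * a ^ m * a
  a²ᵐ⁺¹≡aᵐaᵐa =
    cong (a *_) (ℤ.^-distribˡ-+-* a m (m ℕ.+ 0) ⟨ trans ⟩ cong (λ k → a ^ m * a ^ k) (ℕ.+-identityʳ m)) ⟨ trans ⟩
    ℤ.*-comm a (a ^ m * a ^ m)

mainTheorem3 : (n : ℕ) → (∃[ m ] n ≡ suc (2 *ℕ m)) →
    (λ' : ℤ) → 0ℤ < λ' →
    (M : Matrix n n) → IsIcube n n λ' M →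
    (j : Fin n) → (v : Fin n → ℤ[i]) → ((r : Fin n) → v r ≡ col M j r) →
    ∃[ a ] ∃[ b ] λ' ≡ a * a + b * b
mainTheorem3 n (m , refl) λ' λ'>0 M M-icube _ _ _ =
  isRationalNorm⇒isSumOfTwoSquares (odd-power⇒isRationalNorm m λ'>0 (icube⇒λ^n-isRationalNorm M λ'>0 M-icube))
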